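{- There is a function $F$, assigning a real number to each pair $(n,\mathcal{D}')$ where $n$ is a positive integer and $\mathcal{D}'$ is a finite multiset of unlabelled graphs, with the following property. Let $G$ be a graph on $n\geq 8$ vertices with average degree $d^*$, and let $\mathcal{D}'\subseteq\mathcal{D}(G)$ be a sub-multiset of the deck missing $k\leq \frac{n}{4}$ cards (i.e. $|\mathcal{D}'|=n-k$). Then $\widetilde{d}=F(n,\mathcal{D}')$ satisfies $0\leq \widetilde{d}-d^*<1$.
   Context: All graphs are finite, simple and undirected. For a vertex $v$ of a graph $G$, the card $G-v$ is the graph obtained by deleting $v$ and all incident edges. The deck $\mathcal{D}(G)$ is the multiset of the isomorphism classes (unlabelled versions) of the cards $G-v$, $v\in V(G)$. The average degree of an $n$-vertex graph with $m$ edges is $2m/n$. -}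

module Defs where

open import Data.Nat using (ℕ; zero; suc; _+_; _*_; _<ᵇ_)
open import Data.Bool using (Bool; true; false; if_then_else_; _∧_)
open import Data.Fin using (Fin; toℕ; punchIn)
open import Data.List using (List; length; lookup; map; allFin)
open import Data.Nat.ListAction using (sum)
open import Data.Product using (Σ; _×_; _,_)
open import Data.Integer using (+_)
open import Data.Rational using (ℚ; _/_; 0ℚ)
open import Function.Bundles using (_↔_; Inverse)
open import Function.Definitions using (Injective)
open import Relation.Binary.PropositionalEquality using (_≡_)

record Graph (n : ℕ) : Set where
  field
    adj    : Fin n → Fin n → Bool
    sym    : ∀ i j → adj i j ≡ adj j i
    irrefl : ∀ i → adj i i ≡ false
open Graph public

edges : ∀ {n} → Graph n → ℕ
edges {n} G = sum (map (λ i → sum (map (λ j →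
  if (toℕ i <ᵇ toℕ j) ∧ adj G i j then 1 else 0) (allFin n))) (allFin n))

-- Average degree 2m/n (convention 0 for the empty graph, irrelevant here).
avgDeg : ∀ {n} → Graph n → ℚ
avgDeg {zero}  G = 0ℚ
avgDeg {suc k} G = (+ (2 * edges G)) / suc k

card : ∀ {n} → Graph (suc n) → Fin (suc n) → Graph n
card G v = record
  { adj    = λ i j → adj G (punchIn v i) (punchIn v j)
  ; sym    = λ i j → sym G (punchIn v i) (punchIn v j)
  ; irrefl = λ i → irrefl G (punchIn v i)
  }

-- A graph together with its number of vertices; considered up to isomorphism.
UGraph : Set
UGraph = Σ ℕ Graph

Iso : UGraph → UGraph → Set
Iso (m , G) (m' , H) =
  Σ (Fin m ↔ Fin m') λ f → ∀ i j → adj H (Inverse.to f i) (Inverse.to f j) ≡ adj G i j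

-- Multisets of unlabelled graphs: lists of graphs, equal up to reordering
-- and isomorphism of the entries.
_≈ᴰ_ : List UGraph → List UGraph → Set
xs ≈ᴰ ys = Σ (Fin (length xs) ↔ Fin (length ys)) λ σ →
  ∀ i → Iso (lookup xs i) (lookup ys (Inverse.to σ i))

IsSubDeck : ∀ {n} → Graph (suc n) → List UGraph → Set
IsSubDeck {n} G D' = Σ (Fin (length D') → Fin (suc n)) λ ι →
  Injective _≡_ _≡_ ι × (∀ i → Iso (lookup D' i) (n , card G (ι i)))

-- Write D = 2m for the degree sum of G.  The card G - v has degree sum D - 2 deg v, so
-- the L = M + 2 available cards have total degree sum M D + 2 Q, where Q is the total
-- degree of the k vertices whose cards are missing.  Dividing by M n therefore
-- overestimates D / n = d* by 2 Q / (M n).  Every degree is at most n - 1, so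
-- 2 Q <= 2 k (n - 1), and k <= n / 4, n >= 8 leave enough cards for this to be < M n.
module Submission where

open import Defs
open import Data.Nat using (ℕ; suc; _+_; _*_; _≤_)
open import Data.List using (List; length)
open import Data.Product using (Σ; _×_)
open import Data.Rational using (ℚ; 0ℚ; 1ℚ; _-_) renaming (_≤_ to _≤ℚ_; _<_ to _<ℚ_)
open import Relation.Binary.PropositionalEquality using (_≡_)

open import Data.Nat using (zero; _∸_; _<_; _<ᵇ_; z≤n; s≤s)
open import Data.Nat.Properties
open import Data.Nat.Tactic.RingSolver using (solve-∀)
import Data.Nat.ListAction as List
open import Data.Bool using (Bool; true; false; if_then_else_; _∧_; T)
open import Data.Unit using (tt)
open import Data.Empty using (⊥-elim)
open import Relation.Nullary using (¬_)
open import Data.Fin using (Fin; toℕ; punchIn; punchOut)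
import Data.Fin as Fin
open import Data.Fin.Properties using (toℕ-injective; punchIn-punchOut; punchOut-injective)
  renaming (0≢1+n to Fin-0≢1+n; suc-injective to Fin-suc-injective)
open import Data.Fin.Permutation using (↔⇒≡)
open import Data.List using (lookup; map; allFin; tabulate)
open import Data.List.Properties using (map-tabulate; map-cong)
open import Data.Product using (_,_; proj₁; proj₂)
import Data.Integer as ℤ
import Data.Integer.Properties as ℤ
open import Data.Rational using (_/_; -_; toℚᵘ)
import Data.Rational.Properties as ℚ
import Data.Rational.Unnormalised as ℚᵘ
import Data.Rational.Unnormalised.Properties as ℚᵘ
open import Function using (_∘_; id)
open import Function.Bundles using (Inverse)
open import Function.Definitions using (Injective)
import Relation.Binary.PropositionalEquality as ≡
open ≡ using (_≢_; refl; trans; cong; cong₂; subst; subst₂; module ≡-Reasoning)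
open import Algebra.Properties.Semiring.Sum +-*-semiring

sum-const : ∀ n c → sum {n} (λ _ → c) ≡ n * c
sum-const zero    c = refl
sum-const (suc n) c = cong (c +_) (sum-const n c)

sum-≤-* : ∀ {n} (f : Fin n → ℕ) {B} → (∀ i → f i ≤ B) → sum f ≤ n * B
sum-≤-* {zero}  f f≤B = z≤n
sum-≤-* {suc n} f f≤B = +-mono-≤ (f≤B Fin.zero) (sum-≤-* (f ∘ Fin.suc) (f≤B ∘ Fin.suc))

sum-allFin : ∀ {n} (f : Fin n → ℕ) → List.sum (map f (allFin n)) ≡ sum f
sum-allFin f = trans (cong List.sum (map-tabulate id f)) (sum-tabulate f)
  where
  sum-tabulate : ∀ {n} (f : Fin n → ℕ) → List.sum (tabulate f) ≡ sum f
  sum-tabulate {zero}  f = refl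
  sum-tabulate {suc n} f = cong (f Fin.zero +_) (sum-tabulate (f ∘ Fin.suc))

sum-injection-complement : ∀ {L k N} (ι : Fin L → Fin N) → Injective _≡_ _≡_ ι → L + k ≡ N →
  (f : Fin N → ℕ) {B : ℕ} → (∀ v → f v ≤ B) →
  Σ ℕ λ Q → sum f ≡ sum (f ∘ ι) + Q × Q ≤ k * B
sum-injection-complement {zero} ι _ refl f f≤B = sum f , refl , sum-≤-* f f≤B
sum-injection-complement {suc L} {N = zero} ι _ ()
sum-injection-complement {suc L} {k} {suc N} ι ι-inj L+k≡N f {B} f≤B = Q , equation , Q≤
  where
  w = ι Fin.zero
  w≢ι : ∀ i → w ≢ ι (Fin.suc i)
  w≢ι i = Fin-0≢1+n ∘ ι-inj
  ι′ : Fin L → Fin N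
  ι′ i = punchOut (w≢ι i)
  ι′-inj : Injective _≡_ _≡_ ι′
  ι′-inj {i} {j} e = Fin-suc-injective (ι-inj (punchOut-injective (w≢ι i) (w≢ι j) e))
  complement = sum-injection-complement ι′ ι′-inj (suc-injective L+k≡N) (f ∘ punchIn w) (f≤B ∘ punchIn w)
  Q = proj₁ complement
  Q≤ = proj₂ (proj₂ complement)
  open ≡-Reasoning
  equation : sum f ≡ sum (f ∘ ι) + Q
  equation = begin
    sum f                                ≡⟨ sum-remove f ⟩
    f w + sum (f ∘ punchIn w)            ≡⟨ cong (f w +_) (proj₁ (proj₂ complement)) ⟩
    f w + (sum (f ∘ punchIn w ∘ ι′) + Q) ≡⟨ ≡.sym (+-assoc (f w) _ Q) ⟩
    f w + sum (f ∘ punchIn w ∘ ι′) + Q   ≡⟨ cong (λ x → f w + x + Q)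
                                              (sum-cong-≗ (cong f ∘ punchIn-punchOut ∘ w≢ι)) ⟩
    sum (f ∘ ι) + Q                      ∎

indicator : Bool → ℕ
indicator b = if b then 1 else 0

degree : ∀ {n} → Graph n → Fin n → ℕ
degree G i = sum (λ j → indicator (adj G i j))

degreeSum : ∀ {n} → Graph n → ℕ
degreeSum G = sum (degree G)

upperAdj : ∀ {n} → Graph n → Fin n → Fin n → ℕ
upperAdj G i j = if (toℕ i <ᵇ toℕ j) ∧ adj G i j then 1 else 0

edges≡sum-upperAdj : ∀ {n} (G : Graph n) → edges G ≡ sum (λ i → sum (upperAdj G i))
edges≡sum-upperAdj {n} G = trans
  (cong List.sum (map-cong (λ i → sum-allFin (upperAdj G i)) (allFin n)))
  (sum-allFin (λ i → sum (upperAdj G i)))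

indicator-adj≡upperAdj+upperAdj : ∀ {n} (G : Graph n) i j →
  indicator (adj G i j) ≡ upperAdj G i j + upperAdj G j i
indicator-adj≡upperAdj+upperAdj G i j with toℕ i <ᵇ toℕ j in i<j | toℕ j <ᵇ toℕ i in j<i
... | true  | true  = ⊥-elim (<-asym (<ᵇ-true (toℕ i) (toℕ j) i<j) (<ᵇ-true (toℕ j) (toℕ i) j<i))
  where
  <ᵇ-true : ∀ m n → (m <ᵇ n) ≡ true → m < n
  <ᵇ-true m n e = <ᵇ⇒< m n (subst T (≡.sym e) tt)
... | true  | false = ≡.sym (+-identityʳ _)
... | false | true  = cong indicator (Graph.sym G i j)
... | false | false = subst (λ x → indicator (adj G i x) ≡ 0) i≡j (cong indicator (irrefl G i))
  where
  <ᵇ-false : ∀ m n → (m <ᵇ n) ≡ false → ¬ m < n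
  <ᵇ-false m n e m<n = subst T e (<⇒<ᵇ m<n)
  i≡j = toℕ-injective (≤-antisym (≮⇒≥ (<ᵇ-false (toℕ j) (toℕ i) j<i)) (≮⇒≥ (<ᵇ-false (toℕ i) (toℕ j) i<j)))

handshake : ∀ {n} (G : Graph n) → degreeSum G ≡ 2 * edges G
handshake G = begin
  sum (λ i → sum (λ j → indicator (adj G i j)))
    ≡⟨ sum-cong-≗ (λ i → sum-cong-≗ (indicator-adj≡upperAdj+upperAdj G i)) ⟩
  sum (λ i → sum (λ j → upperAdj G i j + upperAdj G j i))
    ≡⟨ sum-cong-≗ (λ i → ∑-distrib-+ (upperAdj G i) (λ j → upperAdj G j i)) ⟩
  sum (λ i → sum (upperAdj G i) + sum (λ j → upperAdj G j i))
    ≡⟨ ∑-distrib-+ (λ i → sum (upperAdj G i)) (λ i → sum (λ j → upperAdj G j i)) ⟩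
  E + sum (λ i → sum (λ j → upperAdj G j i))
    ≡⟨ cong (E +_) (≡.sym (∑-comm (upperAdj G))) ⟩
  E + E
    ≡⟨ cong (E +_) (≡.sym (+-identityʳ E)) ⟩
  2 * E
    ≡⟨ cong (2 *_) (≡.sym (edges≡sum-upperAdj G)) ⟩
  2 * edges G ∎
  where
  open ≡-Reasoning
  E = sum (λ i → sum (upperAdj G i))

degreeSum-cong : ∀ {m m′} {G : Graph m} {H : Graph m′} → Iso (m , G) (m′ , H) → degreeSum G ≡ degreeSum H
degreeSum-cong {G = G} {H} (σ , σ-adj) = begin
  sum (λ i → sum (λ j → indicator (adj G i j)))
    ≡⟨ sum-cong-≗ (λ i → sum-cong-≗ (λ j → cong indicator (≡.sym (σ-adj i j)))) ⟩
  sum (λ i → sum (λ j → indicator (adj H (to i) (to j))))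
    ≡⟨ sum-cong-≗ (λ i → ≡.sym (sum-permute (λ j → indicator (adj H (to i) j)) σ)) ⟩
  sum (degree H ∘ to)
    ≡⟨ ≡.sym (sum-permute (degree H) σ) ⟩
  sum (degree H) ∎
  where
  open ≡-Reasoning
  to = Inverse.to σ

degree≡sum-punchIn : ∀ {n} (G : Graph (suc n)) v →
  degree G v ≡ sum (λ j → indicator (adj G v (punchIn v j)))
degree≡sum-punchIn G v = trans (sum-remove {i = v} (λ j → indicator (adj G v j)))
  (cong (λ b → indicator b + sum (λ j → indicator (adj G v (punchIn v j)))) (irrefl G v))

degree≤ : ∀ {n} (G : Graph (suc n)) v → degree G v ≤ n
degree≤ {n} G v = begin
  degree G v                                    ≡⟨ degree≡sum-punchIn G v ⟩
  sum (λ j → indicator (adj G v (punchIn v j))) ≤⟨ sum-≤-* _ (λ j → indicator≤1 (adj G v (punchIn v j))) ⟩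
  n * 1                                         ≡⟨ *-identityʳ n ⟩
  n                                             ∎
  where
  open ≤-Reasoning
  indicator≤1 : ∀ b → indicator b ≤ 1
  indicator≤1 true  = ≤-refl
  indicator≤1 false = z≤n

degreeSum-card : ∀ {n} (G : Graph (suc n)) v → degreeSum G ≡ 2 * degree G v + degreeSum (card G v)
degreeSum-card G v = begin
  sum (degree G)
    ≡⟨ sum-remove {i = v} (degree G) ⟩
  d + sum (λ i → degree G (punchIn v i))
    ≡⟨ cong (d +_) (sum-cong-≗ (λ i → sum-remove {i = v} (λ j → indicator (adj G (punchIn v i) j)))) ⟩
  d + sum (λ i → indicator (adj G (punchIn v i) v) + degree (card G v) i)
    ≡⟨ cong (d +_) (∑-distrib-+ _ (degree (card G v))) ⟩
  d + (sum (λ i → indicator (adj G (punchIn v i) v)) + degreeSum (card G v))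
    ≡⟨ cong (λ x → d + (x + degreeSum (card G v))) edges-at-v ⟩
  d + (d + degreeSum (card G v))
    ≡⟨ ≡.sym (+-assoc d d _) ⟩
  d + d + degreeSum (card G v)
    ≡⟨ cong (λ x → d + x + degreeSum (card G v)) (≡.sym (+-identityʳ d)) ⟩
  2 * d + degreeSum (card G v) ∎
  where
  open ≡-Reasoning
  d = degree G v
  edges-at-v : sum (λ i → indicator (adj G (punchIn v i) v)) ≡ d
  edges-at-v = trans (sum-cong-≗ (λ i → cong indicator (Graph.sym G (punchIn v i) v)))
                     (≡.sym (degree≡sum-punchIn G v))

sum-degreeSum-card : ∀ {n k L M} (G : Graph (suc n)) (ι : Fin L → Fin (suc n)) → Injective _≡_ _≡_ ι →
  L + k ≡ suc n → L ≡ 2 + M →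
  Σ ℕ λ Q → sum (λ i → degreeSum (card G (ι i))) ≡ M * degreeSum G + 2 * Q × Q ≤ k * n
sum-degreeSum-card {n} {k} {M = M} G ι ι-inj L+k≡N refl =
  Q , subst (λ D → S ≡ M * D + 2 * Q) (≡.sym D≡P+Q) (cancel-cards (begin
    2 * P + S
      ≡⟨ cong (_+ S) (*-distribˡ-sum 2 (degree G ∘ ι)) ⟩
    sum (λ i → 2 * degree G (ι i)) + S
      ≡⟨ ≡.sym (∑-distrib-+ (λ i → 2 * degree G (ι i)) (λ i → degreeSum (card G (ι i)))) ⟩
    sum (λ i → 2 * degree G (ι i) + degreeSum (card G (ι i)))
      ≡⟨ sum-cong-≗ (λ i → ≡.sym (degreeSum-card G (ι i))) ⟩
    sum {2 + M} (λ _ → degreeSum G)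
      ≡⟨ sum-const (2 + M) (degreeSum G) ⟩
    (2 + M) * degreeSum G
      ≡⟨ cong ((2 + M) *_) D≡P+Q ⟩
    (2 + M) * (P + Q) ∎)) , Q≤
  where
  open ≡-Reasoning
  S = sum (λ i → degreeSum (card G (ι i)))
  P = sum (degree G ∘ ι)
  complement = sum-injection-complement ι ι-inj L+k≡N (degree G) (degree≤ G)
  Q = proj₁ complement
  D≡P+Q = proj₁ (proj₂ complement)
  Q≤ = proj₂ (proj₂ complement)
  cancel-cards : 2 * P + S ≡ (2 + M) * (P + Q) → S ≡ M * (P + Q) + 2 * Q
  cancel-cards e = +-cancelˡ-≡ (2 * P) S _ (trans e (expand P Q M))
    where
    expand : ∀ P Q M → (2 + M) * (P + Q) ≡ 2 * P + (M * (P + Q) + 2 * Q)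
    expand = solve-∀

deck-size : ∀ k {L N} → L + k ≡ N → 4 * k ≤ N → 8 ≤ N → Σ ℕ λ M → L ≡ 3 + M × 2 * k ≤ suc M
deck-size zero {L} refl _ 8≤L+0
  with t , 3+t≡L ← m≤n⇒∃[o]m+o≡n (≤-trans (m≤m+n 3 5) (subst (8 ≤_) (+-identityʳ L) 8≤L+0))
  = t , ≡.sym 3+t≡L , z≤n
deck-size (suc zero) {L} refl _ 8≤L+1
  with t , 7+t≡L ← m≤n⇒∃[o]m+o≡n (+-cancelʳ-≤ 1 7 L 8≤L+1)
  = 4 + t , ≡.sym 7+t≡L , s≤s (s≤s z≤n)
-- Here 4 * k and 3 * k unfold to k + 3 * k and k + 2 * k.
deck-size k@(suc (suc _)) {L} refl 4k≤L+k _
  with 3k≤L ← +-cancelˡ-≤ k (3 * k) L (subst (4 * k ≤_) (+-comm L k) 4k≤L+k)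
  with t , e ← m≤n⇒∃[o]m+o≡n (≤-trans (+-monoˡ-≤ (2 * k) (s≤s (s≤s z≤n))) 3k≤L)
  = _ , ≡.sym e , m≤m+n (2 * k) t

twice-≤-*-< : ∀ {Q k n M} → Q ≤ k * n → 2 * k ≤ suc M → 2 * Q < suc M * suc n
twice-≤-*-< {Q} {k} {n} {M} Q≤kn 2k≤1+M = begin-strict
  2 * Q       ≤⟨ *-monoʳ-≤ 2 Q≤kn ⟩
  2 * (k * n) ≡⟨ ≡.sym (*-assoc 2 k n) ⟩
  2 * k * n   ≤⟨ *-monoˡ-≤ n 2k≤1+M ⟩
  suc M * n   <⟨ *-monoʳ-< (suc M) (n<1+n n) ⟩
  suc M * suc n ∎
  where open ≤-Reasoning

SmallExcess : ℚ → ℚ → Set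
SmallExcess p q = (0ℚ ≤ℚ (p - q)) × ((p - q) <ℚ 1ℚ)

-- ratio a 0 = 0 is a junk value; under the hypotheses of the theorem the estimate
-- always divides by a positive number.
ratio : ℕ → ℕ → ℚ
ratio a zero    = 0ℚ
ratio a (suc b) = ℤ.+ a / suc b

/-difference-bounds : ∀ a b c d → c * suc b ≤ a * suc d → a * suc d < c * suc b + suc b * suc d →
  SmallExcess (ℤ.+ a / suc b) (ℤ.+ c / suc d)
/-difference-bounds a b c d lower upper =
  ℚ.toℚᵘ-cancel-≤ (ℚᵘ.≤-respʳ-≃ (ℚᵘ.≃-sym toℚᵘ-difference) 0≤X) ,
  ℚ.toℚᵘ-cancel-< (ℚᵘ.<-respˡ-≃ (ℚᵘ.≃-sym toℚᵘ-difference) X<1)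
  where
  X = ℚᵘ.mkℚᵘ (ℤ.+ a) b ℚᵘ.- ℚᵘ.mkℚᵘ (ℤ.+ c) d
  toℚᵘ-difference : toℚᵘ (ℤ.+ a / suc b - ℤ.+ c / suc d) ℚᵘ.≃ X
  toℚᵘ-difference = ℚᵘ.≃-trans (ℚ.toℚᵘ-homo-+ (ℤ.+ a / suc b) (- (ℤ.+ c / suc d)))
    (ℚᵘ.+-cong (ℚ.toℚᵘ-fromℚᵘ (ℚᵘ.mkℚᵘ (ℤ.+ a) b))
      (ℚᵘ.≃-trans (ℚ.toℚᵘ-homo‿- (ℤ.+ c / suc d)) (ℚᵘ.-‿cong (ℚ.toℚᵘ-fromℚᵘ (ℚᵘ.mkℚᵘ (ℤ.+ c) d)))))
  numerator : ℚᵘ.↥ X ≡ ℤ.+ (a * suc d ∸ c * suc b)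
  numerator = begin
    ℚᵘ.↥ X
      ≡⟨ cong₂ ℤ._+_ (≡.sym (ℤ.pos-* a (suc d))) (≡.sym (ℤ.neg-distribˡ-* (ℤ.+ c) (ℤ.+ suc b))) ⟩
    ℤ.+ (a * suc d) ℤ.+ ℤ.- (ℤ.+ c ℤ.* ℤ.+ suc b)
      ≡⟨ cong (λ z → ℤ.+ (a * suc d) ℤ.+ ℤ.- z) (≡.sym (ℤ.pos-* c (suc b))) ⟩
    ℤ.+ (a * suc d) ℤ.+ ℤ.- ℤ.+ (c * suc b)
      ≡⟨ ℤ.m-n≡m⊖n (a * suc d) (c * suc b) ⟩
    (a * suc d) ℤ.⊖ (c * suc b)
      ≡⟨ ℤ.⊖-≥ lower ⟩
    ℤ.+ (a * suc d ∸ c * suc b) ∎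
    where open ≡-Reasoning
  numerator′ : ℚᵘ.↥ X ℤ.* ℤ.+ 1 ≡ ℤ.+ (a * suc d ∸ c * suc b)
  numerator′ = trans (ℤ.*-identityʳ (ℚᵘ.↥ X)) numerator
  0≤X : ℚᵘ.0ℚᵘ ℚᵘ.≤ X
  0≤X = ℚᵘ.*≤* (subst (ℤ.+ 0 ℤ.≤_) (≡.sym numerator′) (ℤ.+≤+ z≤n))
  X<1 : X ℚᵘ.< ℚᵘ.1ℚᵘ
  X<1 = ℚᵘ.*<* (subst₂ ℤ._<_ (≡.sym numerator′) (≡.sym (ℤ.*-identityˡ (ℚᵘ.↧ X)))
          (ℤ.+<+ (m<n+o⇒m∸n<o _ _ upper)))

ratio-excess-bounds : ∀ {a c r d m} → a ≡ suc m * c + r → r < suc m * suc d →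
  SmallExcess (ratio a (suc d * suc m)) (ℤ.+ c / suc d)
ratio-excess-bounds {c = c} {r} {d} {m} refl r<m′d′ =
  /-difference-bounds (suc m * c + r) (m + d * suc m) c d
    (subst (c * B ≤_) (≡.sym cross) (m≤m+n (c * B) (r * suc d)))
    (subst (_< c * B + B * suc d) (≡.sym cross)
      (+-monoʳ-< (c * B) (*-monoˡ-< (suc d) (subst (r <_) (*-comm (suc m) (suc d)) r<m′d′))))
  where
  B = suc d * suc m
  cross : (suc m * c + r) * suc d ≡ c * B + r * suc d
  cross = expand m c r d
    where
    expand : ∀ m c r d → (suc m * c + r) * suc d ≡ c * (suc d * suc m) + r * suc d
    expand = solve-∀

degreeSumᵘ : UGraph → ℕ
degreeSumᵘ (_ , G) = degreeSum G

degreeSumᵘ-cong : ∀ x y → Iso x y → degreeSumᵘ x ≡ degreeSumᵘ y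
degreeSumᵘ-cong (_ , G) (_ , H) = degreeSum-cong {G = G} {H}

deckDegreeSum : List UGraph → ℕ
deckDegreeSum D = sum (λ i → degreeSumᵘ (lookup D i))

estimate : ℕ → List UGraph → ℚ
estimate N D = ratio (deckDegreeSum D) (N * (length D ∸ 2))

estimate-cong : ∀ N D₁ D₂ → D₁ ≈ᴰ D₂ → estimate N D₁ ≡ estimate N D₂
estimate-cong N D₁ D₂ (σ , σ-iso) = cong₂ (λ S L → ratio S (N * (L ∸ 2))) deckDegreeSum-≡ (↔⇒≡ σ)
  where
  deckDegreeSum-≡ : deckDegreeSum D₁ ≡ deckDegreeSum D₂
  deckDegreeSum-≡ = trans
    (sum-cong-≗ (λ i → degreeSumᵘ-cong (lookup D₁ i) (lookup D₂ (Inverse.to σ i)) (σ-iso i)))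
    (≡.sym (sum-permute (λ j → degreeSumᵘ (lookup D₂ j)) σ))

degreeSum/≡avgDeg : ∀ {n} (G : Graph (suc n)) → ℤ.+ degreeSum G / suc n ≡ avgDeg G
degreeSum/≡avgDeg {n} G = cong (λ m → ℤ.+ m / suc n) (handshake G)

estimate-bounds : ∀ {n k L} (G : Graph (suc n)) (ι : Fin L → Fin (suc n)) → Injective _≡_ _≡_ ι →
  L + k ≡ suc n → Σ ℕ (λ M → L ≡ 3 + M × 2 * k ≤ suc M) →
  ∀ {S} → S ≡ sum (λ i → degreeSum (card G (ι i))) →
  SmallExcess (ratio S (suc n * (L ∸ 2))) (avgDeg G)
estimate-bounds {n} {k} G ι ι-inj L+k≡N (M , refl , 2k≤1+M) {S} S≡ =
  subst (SmallExcess (ratio S (suc n * suc M))) (degreeSum/≡avgDeg G)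
    (ratio-excess-bounds {S} {degreeSum G} {2 * Q} {n} {M} (trans S≡ cards≡)
      (twice-≤-*-< {k = k} Q≤kn 2k≤1+M))
  where
  cards = sum-degreeSum-card G ι ι-inj L+k≡N refl
  Q = proj₁ cards
  cards≡ = proj₁ (proj₂ cards)
  Q≤kn = proj₂ (proj₂ cards)

lemma2p2 : Σ (ℕ → List UGraph → ℚ) λ F →
    (∀ n D₁ D₂ → D₁ ≈ᴰ D₂ → F n D₁ ≡ F n D₂)
    × (∀ n (G : Graph (suc n)) → 8 ≤ suc n →
        ∀ k (D' : List UGraph) → length D' + k ≡ suc n → 4 * k ≤ suc n →
        IsSubDeck G D' →
        (0ℚ ≤ℚ (F (suc n) D' - avgDeg G)) × ((F (suc n) D' - avgDeg G) <ℚ 1ℚ))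
lemma2p2 = estimate , estimate-cong ,
  λ n G 8≤N k D' |D'|+k≡N 4k≤N (ι , ι-inj , ι-cards) →
    estimate-bounds G ι ι-inj |D'|+k≡N (deck-size k |D'|+k≡N 4k≤N 8≤N)
      (sum-cong-≗ (λ i → degreeSumᵘ-cong (lookup D' i) (n , card G (ι i)) (ι-cards i)))
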